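{- Let $T$ be a tree with at least one edge and let $n$ be a positive integer such that $|V(T)|\ge n^2+(s(T)-2)(n-1)+1$. Then $T$ has $n$ pairwise vertex-disjoint subtrees, each with at least $n$ vertices.
   Context: All graphs are finite, simple and undirected. For a graph $G$, $s(G)$ denotes the maximum integer $t$ such that the star $S_t=K_{1,t}$ (with $t$ leaves) is a minor of $G$. -}

module Defs where

open import Data.Nat using (ℕ; zero; suc; _≤_)
open import Data.Fin using (Fin; zero; suc)
open import Data.Bool using (Bool; true; false)
open import Data.List using (List; []; _∷_; _++_; [_]; length)
open import Data.List.Membership.Propositional using (_∈_; _∉_)
open import Data.List.Relation.Unary.Unique.Propositional using (Unique)
open import Data.Product using (Σ; _×_; ∃; ∃-syntax; _,_)
open import Data.Unit using (⊤)
open import Data.Empty using (⊥)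
open import Relation.Nullary using (¬_)
open import Relation.Binary.PropositionalEquality using (_≡_; _≢_; refl)

record Graph : Set where
  field
    N      : ℕ
    adj    : Fin N → Fin N → Bool
    sym    : ∀ u v → adj u v ≡ adj v u
    irrefl : ∀ v → adj v v ≡ false

open Graph public

E : (G : Graph) → Fin (N G) → Fin (N G) → Set
E G u v = adj G u v ≡ true

HasEdge : Graph → Set
HasEdge G = ∃[ u ] ∃[ v ] E G u v

data Reach (G : Graph) (S : Fin (N G) → Set) (u : Fin (N G)) : Fin (N G) → Set where
  here : S u → Reach G S u u
  step : ∀ {v w} → Reach G S u v → S w → E G v w → Reach G S u w

ConnectedSet : (G : Graph) → (Fin (N G) → Set) → Set
ConnectedSet G S = ∀ u v → S u → S v → Reach G S u v

Connected : Graph → Set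
Connected G = ConnectedSet G (λ _ → ⊤)

Walk : (G : Graph) → List (Fin (N G)) → Set
Walk G []            = ⊤
Walk G (x ∷ [])      = ⊤
Walk G (x ∷ y ∷ xs)  = E G x y × Walk G (y ∷ xs)

HasCycle : Graph → Set
HasCycle G = Σ (Fin (N G)) λ x → Σ (List (Fin (N G))) λ ys →
  (2 ≤ length ys) × Unique (x ∷ ys) × Walk G ((x ∷ ys) ++ [ x ])

IsTree : Graph → Set
IsTree G = Connected G × ¬ HasCycle G

record MinorModel (H G : Graph) : Set₁ where
  field
    branch    : Fin (N H) → Fin (N G) → Set
    nonempty  : ∀ i → ∃[ v ] branch i v
    connected : ∀ i → ConnectedSet G (branch i)
    disjoint  : ∀ i j v → i ≢ j → branch i v → branch j v → ⊥
    edges     : ∀ i j → E H i j → ∃[ u ] ∃[ v ] (branch i u × branch j v × E G u v)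

IsMinor : Graph → Graph → Set₁
IsMinor H G = MinorModel H G

starAdj : ∀ t → Fin (suc t) → Fin (suc t) → Bool
starAdj t zero    zero    = false
starAdj t zero    (suc _) = true
starAdj t (suc _) zero    = true
starAdj t (suc _) (suc _) = false

starSym : ∀ t u v → starAdj t u v ≡ starAdj t v u
starSym t zero    zero    = refl
starSym t zero    (suc _) = refl
starSym t (suc _) zero    = refl
starSym t (suc _) (suc _) = refl

starIrrefl : ∀ t v → starAdj t v v ≡ false
starIrrefl t zero    = refl
starIrrefl t (suc _) = refl

Star : ℕ → Graph
Star t = record { N = suc t ; adj = starAdj t ; sym = starSym t ; irrefl = starIrrefl t }

IsStarMinorNumber : Graph → ℕ → Set₁
IsStarMinorNumber G s = IsMinor (Star s) G × (∀ t → IsMinor (Star t) G → t ≤ s)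

-- n pairwise vertex-disjoint subtrees of the tree T, each with ≥ n vertices
-- (a subtree of a tree is determined by its vertex set, which must induce a
-- connected subgraph; vertex sets are given as duplicate-free lists)
DisjointSubtrees : (T : Graph) → ℕ → Set
DisjointSubtrees T n = Σ (Fin n → List (Fin (N T))) λ Ts →
    (∀ i → Unique (Ts i))
  × (∀ i → n ≤ length (Ts i))
  × (∀ i → ConnectedSet T (λ v → v ∈ Ts i))
  × (∀ i j v → i ≢ j → v ∈ Ts i → v ∉ Ts j)

module Submission where

-- Proof idea (only connectivity of T is used).  Fix a rooted spanning tree,
-- given by parent pointers.  Contracting its internal vertices to one vertex
-- shows that its leaves form a star minor, so it has μ ≤ s leaves.  Write
-- n = q + 1 and call a vertex set R closed if it contains the root and the
-- parent of each of its vertices.  In a closed R, a deepest vertex v whose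
-- subtree has ≥ n vertices has k children whose subtrees have ≤ q vertices;
-- so that subtree has ≤ 1 + kq vertices, and cutting it off loses ≥ k leaves
-- while creating ≤ 1 new one.  Hence the budget m·n + μ(R)·q + 1 ≤ |R| + 2q
-- for m pieces in R yields the same budget for m − 1 pieces in the rest,
-- and for m = n it is exactly the hypothesis of the theorem.

module Proof where

  open import Defs hiding (sym)
  open import Data.Nat using (ℕ; zero; suc; _+_; _*_; _≤_; _<_; z≤n; s≤s; _<?_; _≤?_)
  open import Data.Nat.Properties
    using (suc-injective; +-*-semiring; ≤-refl; ≤-trans; ≤-reflexive; ≤-pred; +-mono-≤; +-monoˡ-≤; +-monoʳ-≤;
           *-monoˡ-≤; *-monoʳ-≤; +-cancelʳ-≤; m≤m+n; m≤n+m; +-identityʳ; *-zeroʳ; +-comm; +-assoc; +-suc;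
           0≢1+n; <-irrefl; <⇒≤; <⇒≱; ≮⇒≥; ≰⇒>; module ≤-Reasoning)
  open import Data.Nat.Tactic.RingSolver using (solve-∀)
  open import Algebra.Properties.Semiring.Sum +-*-semiring
    using (sum; sum-cong-≗; sum-replicate-zero; ∑-distrib-+; ∑-comm; *-distribˡ-sum; *-distribʳ-sum)
  open import Data.Fin using (Fin; zero; suc; _≟_)
  open import Data.Fin.Properties using (any?)
  import Data.Fin.Properties as Fin
  open import Data.Bool using (Bool; true; false; _∧_; _∨_; not; if_then_else_)
  import Data.Bool as Bool
  open import Data.Bool.Properties using (∧-conicalˡ; ∧-conicalʳ; ∧-identityʳ; ∨-identityʳ; ¬-not)
  open import Data.List using (List; []; _∷_; map; length; lookup)
  open import Data.List.Properties using (length-map)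
  open import Data.List.Membership.Propositional using (_∈_)
  open import Data.List.Membership.Propositional.Properties using (∈-map⁺; ∈-map⁻; ∈-lookup)
  open import Data.List.Relation.Unary.Any using (here; there)
  open import Data.List.Relation.Unary.All using (All; []; _∷_)
  import Data.List.Relation.Unary.All as All
  open import Data.List.Relation.Unary.Unique.Propositional using (Unique; []; _∷_)
  import Data.List.Relation.Unary.Unique.Propositional.Properties as Unique
  open import Data.Product using (Σ; _×_; _,_; proj₁; proj₂)
  open import Data.Sum using (_⊎_; inj₁; inj₂)
  open import Data.Empty using (⊥; ⊥-elim)
  open import Data.Unit using (⊤; tt)
  open import Relation.Nullary using (¬_; Dec; yes; no; does; contradiction)
  open import Relation.Nullary.Decidable using (dec-true; dec-false; map′; ¬?; _×-dec_)
  open import Relation.Binary.PropositionalEquality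

  holds : ∀ {ℓ} {A : Set ℓ} (a? : Dec A) → does a? ≡ true → A
  holds (yes a) _ = a

  fails : ∀ {ℓ} {A : Set ℓ} (a? : Dec A) → does a? ≡ false → ¬ A
  fails (no ¬a) _ = ¬a

  ∧-intro : ∀ {b c} → b ≡ true → c ≡ true → b ∧ c ≡ true
  ∧-intro refl refl = refl

  true≢false : true ≢ false
  true≢false ()

  not-true : ∀ {b} → not b ≡ true → b ≡ false
  not-true {false} _ = refl

  bool-ext : ∀ {b c} → (b ≡ true → c ≡ true) → (c ≡ true → b ≡ true) → b ≡ c
  bool-ext {false} {false} _ _ = refl
  bool-ext {false} {true}  _ c⇒b = c⇒b refl
  bool-ext {true}  {_}     b⇒c _ = sym (b⇒c refl)

  ind : Bool → ℕ
  ind true  = 1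
  ind false = 0

  count : ∀ {N} → (Fin N → Bool) → ℕ
  count A = sum (λ i → ind (A i))

  ind≤1 : ∀ b → ind b ≤ 1
  ind≤1 true  = ≤-refl
  ind≤1 false = z≤n

  ind-mono : ∀ {b c} → (b ≡ true → c ≡ true) → ind b ≤ ind c
  ind-mono {false} h = z≤n
  ind-mono {true}  h rewrite h refl = ≤-refl

  ind≤ : ∀ b {x} → (b ≡ true → 1 ≤ x) → ind b ≤ x
  ind≤ false h = z≤n
  ind≤ true  h = h refl

  ind-∧ : ∀ b c → ind (b ∧ c) ≡ ind b * ind c
  ind-∧ false c = refl
  ind-∧ true  c = sym (+-identityʳ (ind c))

  sum-mono : ∀ {N} {f g : Fin N → ℕ} → (∀ i → f i ≤ g i) → sum f ≤ sum g
  sum-mono {zero}  h = z≤n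
  sum-mono {suc N} h = +-mono-≤ (h zero) (sum-mono (λ i → h (suc i)))

  term≤sum : ∀ {N} (f : Fin N → ℕ) x → f x ≤ sum f
  term≤sum f zero    = m≤m+n (f zero) _
  term≤sum f (suc x) = ≤-trans (term≤sum (λ i → f (suc i)) x) (m≤n+m _ (f zero))

  sum-zero : ∀ {N} {f : Fin N → ℕ} → (∀ i → f i ≡ 0) → sum f ≡ 0
  sum-zero {N} h = trans (sum-cong-≗ h) (sum-replicate-zero N)

  sum-ones : ∀ N → sum {N} (λ _ → 1) ≡ N
  sum-ones zero    = refl
  sum-ones (suc N) = cong suc (sum-ones N)

  member≤count : ∀ {N} (A : Fin N → Bool) {x} → A x ≡ true → 1 ≤ count A
  member≤count A {x} ax = ≤-trans (≤-reflexive (cong ind (sym ax))) (term≤sum (λ i → ind (A i)) x)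

  count-mono : ∀ {N} {A B : Fin N → Bool} → (∀ x → A x ≡ true → B x ≡ true) → count A ≤ count B
  count-mono h = sum-mono (λ i → ind-mono (h i))

  count-empty : ∀ {N} {A : Fin N → Bool} → (∀ x → A x ≡ true → ⊥) → count A ≡ 0
  count-empty {A = A} h = sum-zero pointwise
    where
    pointwise : ∀ x → ind (A x) ≡ 0
    pointwise x with A x in ax
    ... | false = refl
    ... | true  = ⊥-elim (h x ax)

  count-split : ∀ {N} (A B : Fin N → Bool) →
                count A ≡ count (λ x → A x ∧ B x) + count (λ x → A x ∧ not (B x))
  count-split A B = trans (sum-cong-≗ pointwise)
    (∑-distrib-+ (λ i → ind (A i ∧ B i)) (λ i → ind (A i ∧ not (B i))))
    where
    pointwise : ∀ i → ind (A i) ≡ ind (A i ∧ B i) + ind (A i ∧ not (B i))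
    pointwise i with A i | B i
    ... | false | _     = refl
    ... | true  | false = refl
    ... | true  | true  = refl

  count-point : ∀ {N} (x : Fin N) → count (λ i → does (i ≟ x)) ≡ 1
  count-point {suc N} zero    = cong suc (count-empty {N} {A = λ i → does (suc i ≟ zero)} (λ _ ()))
  count-point {suc N} (suc x) = trans (sum-cong-≗ shift) (count-point x)
    where
    shift : ∀ i → ind (does (suc i ≟ suc x)) ≡ ind (does (i ≟ x))
    shift i with i ≟ x
    ... | yes _ = refl
    ... | no  _ = refl

  count-subsingleton : ∀ {N} (A : Fin N → Bool) →
                       (∀ x y → A x ≡ true → A y ≡ true → x ≡ y) → count A ≤ 1
  count-subsingleton {zero}  A unique = z≤n
  count-subsingleton {suc N} A unique with A zero in a₀
  ... | false = count-subsingleton (λ i → A (suc i)) (λ x y ax ay → Fin.suc-injective (unique _ _ ax ay))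
  ... | true  = s≤s (≤-reflexive (count-empty {N} {λ i → A (suc i)} (λ i ai → zero≢suc (unique _ _ a₀ ai))))
    where
    zero≢suc : ∀ {i : Fin N} → zero ≢ suc i
    zero≢suc ()

  count-witness : ∀ {N} (A : Fin N → Bool) → 1 ≤ count A → Σ (Fin N) λ x → A x ≡ true
  count-witness {suc N} A nonempty with A zero in a₀
  ... | true  = zero , a₀
  ... | false with count-witness (λ i → A (suc i)) nonempty
  ...   | x , ax = suc x , ax

  count≤ind : ∀ {N} (A : Fin N → Bool) b → (∀ x → A x ≡ true → b ≡ true) →
              (∀ x y → A x ≡ true → A y ≡ true → x ≡ y) → count A ≤ ind b
  count≤ind A true  _    unique = count-subsingleton A unique
  count≤ind A false into _      = ≤-reflexive (count-empty (λ x ax → true≢false (sym (into x ax))))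

  two≤count : ∀ {N} (A : Fin N → Bool) {x y} → x ≢ y → A x ≡ true → A y ≡ true → 2 ≤ count A
  two≤count A {x} {y} x≢y ax ay = begin
    2                                                     ≡⟨ sym (cong₂ _+_ (count-point x) (count-point y)) ⟩
    count (λ i → does (i ≟ x)) + count (λ i → does (i ≟ y)) ≡⟨ sym (∑-distrib-+ (λ i → ind (does (i ≟ x))) _) ⟩
    sum (λ i → ind (does (i ≟ x)) + ind (does (i ≟ y)))     ≤⟨ sum-mono pointwise ⟩
    count A                                               ∎
    where
    open ≤-Reasoning
    pointwise : ∀ i → ind (does (i ≟ x)) + ind (does (i ≟ y)) ≤ ind (A i)
    pointwise i with i ≟ x | i ≟ y
    ... | yes refl | yes refl = ⊥-elim (x≢y refl)
    ... | yes refl | no  _    = ≤-reflexive (cong ind (sym ax))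
    ... | no  _    | yes refl = ≤-reflexive (cong ind (sym ay))
    ... | no  _    | no  _    = z≤n

  count≤1⇒unique : ∀ {N} (A : Fin N → Bool) → count A ≤ 1 →
                   ∀ {x y} → A x ≡ true → A y ≡ true → x ≡ y
  count≤1⇒unique A small {x} {y} ax ay with x ≟ y
  ... | yes x≡y = x≡y
  ... | no  x≢y = contradiction (two≤count A x≢y ax ay) (<⇒≱ (s≤s small))

  count≤2 : ∀ {N} (A : Fin N → Bool) (a b : Fin N) →
            (∀ x → A x ≡ true → x ≡ a ⊎ x ≡ b) → count A ≤ 2
  count≤2 A a b cover = begin
    count A                                               ≤⟨ sum-mono pointwise ⟩
    sum (λ i → ind (does (i ≟ a)) + ind (does (i ≟ b)))     ≡⟨ ∑-distrib-+ (λ i → ind (does (i ≟ a))) _ ⟩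
    count (λ i → does (i ≟ a)) + count (λ i → does (i ≟ b)) ≡⟨ cong₂ _+_ (count-point a) (count-point b) ⟩
    2                                                     ∎
    where
    open ≤-Reasoning
    pointwise : ∀ i → ind (A i) ≤ ind (does (i ≟ a)) + ind (does (i ≟ b))
    pointwise i = ind≤ (A i) λ ai → lemma (cover i ai)
      where
      lemma : i ≡ a ⊎ i ≡ b → 1 ≤ ind (does (i ≟ a)) + ind (does (i ≟ b))
      lemma (inj₁ refl) rewrite dec-true (i ≟ i) refl = s≤s z≤n
      lemma (inj₂ refl) rewrite dec-true (i ≟ i) refl = m≤n+m 1 _

  count-missing : ∀ {N} (A : Fin N → Bool) {x} → A x ≡ false → count A < N
  count-missing {N} A {x} ax = begin
    suc (count A)                                 ≡⟨ cong (_+ count A) (sym (count-point x)) ⟩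
    count (λ i → does (i ≟ x)) + count A          ≡⟨ sym (∑-distrib-+ (λ i → ind (does (i ≟ x))) _) ⟩
    sum (λ i → ind (does (i ≟ x)) + ind (A i))    ≤⟨ sum-mono pointwise ⟩
    sum {N} (λ _ → 1)                             ≡⟨ sum-ones N ⟩
    N                                             ∎
    where
    open ≤-Reasoning
    pointwise : ∀ i → ind (does (i ≟ x)) + ind (A i) ≤ 1
    pointwise i with i ≟ x
    ... | yes refl rewrite ax = ≤-refl
    ... | no  _    = ind≤1 (A i)

  Maximiser : ∀ {N} → (Fin N → Bool) → (Fin N → ℕ) → Set
  Maximiser {N} A f = Σ (Fin N) λ y → A y ≡ true × (∀ z → A z ≡ true → f z ≤ f y)

  maximise : ∀ {N} (A : Fin N → Bool) (f : Fin N → ℕ) {x} → A x ≡ true → Maximiser A f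
  maximise {suc N} A f {x} ax with any? (λ i → A (suc i) Bool.≟ true)
  ... | no none = zero , head x ax , λ { zero _ → ≤-refl ; (suc z) az → ⊥-elim (none (z , az)) }
    where
    head : ∀ x → A x ≡ true → A zero ≡ true
    head zero    ax = ax
    head (suc x) ax = ⊥-elim (none (x , ax))
  ... | yes (_ , ax′) with maximise (λ i → A (suc i)) (λ i → f (suc i)) ax′
  ...   | y , ay , ymax with A zero in a₀ | f (suc y) <? f zero
  ...     | true  | yes fy<f₀ = zero , a₀ , λ { zero _ → ≤-refl ; (suc z) az → ≤-trans (ymax z az) (<⇒≤ fy<f₀) }
  ...     | true  | no  fy≮f₀ = suc y , ay , λ { zero _ → ≮⇒≥ fy≮f₀ ; (suc z) az → ymax z az }
  ...     | false | _         = suc y , ay , λ { zero a₀′ → ⊥-elim (true≢false (trans (sym a₀′) a₀))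
                                               ; (suc z) az → ymax z az }

  enum : ∀ {N} → (Fin N → Bool) → List (Fin N)
  enum {zero}  A = []
  enum {suc N} A = prepend-if (A zero) (map suc (enum (λ i → A (suc i))))
    where
    prepend-if : Bool → List (Fin (suc N)) → List (Fin (suc N))
    prepend-if true  xs = zero ∷ xs
    prepend-if false xs = xs

  enum-length : ∀ {N} (A : Fin N → Bool) → length (enum A) ≡ count A
  enum-length {zero}  A = refl
  enum-length {suc N} A with A zero
  ... | true  = cong suc (trans (length-map suc (enum (λ i → A (suc i)))) (enum-length (λ i → A (suc i))))
  ... | false = trans (length-map suc (enum (λ i → A (suc i)))) (enum-length (λ i → A (suc i)))

  enum-sound : ∀ {N} (A : Fin N → Bool) {x} → x ∈ enum A → A x ≡ true
  enum-sound {suc N} A x∈ with A zero in a₀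
  enum-sound {suc N} A (here refl) | true = a₀
  enum-sound {suc N} A (there x∈) | true with ∈-map⁻ suc x∈
  ... | _ , y∈ , refl = enum-sound (λ i → A (suc i)) y∈
  enum-sound {suc N} A x∈ | false with ∈-map⁻ suc x∈
  ... | _ , y∈ , refl = enum-sound (λ i → A (suc i)) y∈

  enum-complete : ∀ {N} (A : Fin N → Bool) {x} → A x ≡ true → x ∈ enum A
  enum-complete {suc N} A {zero} ax rewrite ax = here refl
  enum-complete {suc N} A {suc y} ay with A zero
  ... | true  = there (∈-map⁺ suc (enum-complete (λ i → A (suc i)) ay))
  ... | false = ∈-map⁺ suc (enum-complete (λ i → A (suc i)) ay)

  enum-unique : ∀ {N} (A : Fin N → Bool) → Unique (enum A)
  enum-unique {zero}  A = []
  enum-unique {suc N} A with A zero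
  ... | true  = zero∉ (enum (λ i → A (suc i))) ∷ tail-unique
    where
    tail-unique = Unique.map⁺ Fin.suc-injective (enum-unique (λ i → A (suc i)))
    zero∉ : (xs : List (Fin N)) → All (zero ≢_) (map suc xs)
    zero∉ []       = []
    zero∉ (_ ∷ xs) = (λ ()) ∷ zero∉ xs
  ... | false = Unique.map⁺ Fin.suc-injective (enum-unique (λ i → A (suc i)))

  lookup-injective : ∀ {X : Set} (xs : List X) → Unique xs → ∀ i j → lookup xs i ≡ lookup xs j → i ≡ j
  lookup-injective (x ∷ xs) (_   ∷ _) zero    zero    _ = refl
  lookup-injective (x ∷ xs) (x∉ ∷ _) zero    (suc j) e = ⊥-elim (All.lookup x∉ (∈-lookup j) e)
  lookup-injective (x ∷ xs) (x∉ ∷ _) (suc i) zero    e = ⊥-elim (All.lookup x∉ (∈-lookup i) (sym e))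
  lookup-injective (x ∷ xs) (_ ∷ u)  (suc i) (suc j) e = cong suc (lookup-injective xs u i j e)

  module Walks (G : Graph) where

    reach-prepend : ∀ {S u v w} → S u → E G u v → Reach G S v w → Reach G S u w
    reach-prepend su e (here sv)      = step (here su) sv e
    reach-prepend su e (step ρ sw e′) = step (reach-prepend su e ρ) sw e′

    reach-sym : ∀ {S u w} → Reach G S u w → Reach G S w u
    reach-sym (here s) = here s
    reach-sym (step {v} {w} ρ sw e) = reach-prepend sw (trans (Graph.sym G w v) e) (reach-sym ρ)

    reach-trans : ∀ {S u v w} → Reach G S u v → Reach G S v w → Reach G S u w
    reach-trans ρ (here _)     = ρ
    reach-trans ρ (step σ s e) = step (reach-trans ρ σ) s e

    reach-mono : ∀ {S S′ : Fin (N G) → Set} {u w} → (∀ x → S x → S′ x) → Reach G S u w → Reach G S′ u w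
    reach-mono h (here s)     = here (h _ s)
    reach-mono h (step ρ s e) = step (reach-mono h ρ) (h _ s) e

    connected-from : ∀ {S} c → (∀ u → S u → Reach G S c u) → ConnectedSet G S
    connected-from c reach u w su sw = reach-trans (reach-sym (reach u su)) (reach w sw)

  record Pieces (G : Graph) (q m : ℕ) (R : Fin (N G) → Bool) : Set where
    field
      piece     : Fin m → Fin (N G) → Bool
      inside    : ∀ i x → piece i x ≡ true → R x ≡ true
      large     : ∀ i → suc q ≤ count (piece i)
      connected : ∀ i → ConnectedSet G (λ x → piece i x ≡ true)
      disjoint  : ∀ i j x → i ≢ j → piece i x ≡ true → piece j x ≡ true → ⊥

  no-pieces : ∀ {G q R} → Pieces G q 0 R
  no-pieces = record { piece = λ () ; inside = λ () ; large = λ () ; connected = λ () ; disjoint = λ () }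

  pieces-to-subtrees : ∀ {G q R} → Pieces G q (suc q) R → DisjointSubtrees G (suc q)
  pieces-to-subtrees {G} {q} P =
      (λ i → enum (piece i))
    , (λ i → enum-unique (piece i))
    , (λ i → subst (suc q ≤_) (sym (enum-length (piece i))) (large i))
    , (λ i u w u∈ w∈ → reach-mono (λ x → enum-complete (piece i))
                                  (connected i u w (enum-sound (piece i) u∈) (enum-sound (piece i) w∈)))
    , (λ i j x i≢j x∈i x∈j → disjoint i j x i≢j (enum-sound (piece i) x∈i) (enum-sound (piece j) x∈j))
    where
    open Pieces P
    open Walks G

  record RootedSpanningTree (G : Graph) (r : Fin (N G)) : Set where
    field
      parent       : Fin (N G) → Fin (N G)
      depth        : Fin (N G) → ℕ
      parent-edge  : ∀ u → u ≢ r → E G (parent u) u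
      parent-depth : ∀ u → u ≢ r → suc (depth (parent u)) ≡ depth u
      depth-root   : depth r ≡ 0

  -- Every connected graph has a rooted spanning tree at any root: grow a tree
  -- from r, attaching one vertex across the boundary at a time.
  module SpanningTreeConstruction (G : Graph) (connected : Connected G) (r : Fin (N G)) where

    private
      V : Set
      V = Fin (N G)

    record PartialTree : Set where
      field
        covered      : V → Bool
        parent       : V → V
        depth        : V → ℕ
        root-covered : covered r ≡ true
        depth-root   : depth r ≡ 0
        parent-ok    : ∀ u → covered u ≡ true → u ≢ r →
                       covered (parent u) ≡ true × E G (parent u) u × suc (depth (parent u)) ≡ depth u

    boundary-edge : (S : V → Bool) → S r ≡ true → ∀ {x} → Reach G (λ _ → ⊤) r x → S x ≡ false →
                    Σ V λ w → Σ V λ u → S w ≡ true × S u ≡ false × E G w u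
    boundary-edge S sr (here _) sx = ⊥-elim (true≢false (trans (sym sr) sx))
    boundary-edge S sr (step {v} ρ _ e) sx with S v in sv
    ... | true  = v , _ , sv , sx , e
    ... | false = boundary-edge S sr ρ sv

    root-only : PartialTree
    root-only = record
      { covered = λ u → does (u ≟ r) ; parent = λ u → u ; depth = λ _ → 0
      ; root-covered = dec-true (r ≟ r) refl ; depth-root = refl
      ; parent-ok = λ u u≡r u≢r → ⊥-elim (u≢r (holds (u ≟ r) u≡r)) }

    attach : (T : PartialTree) → ∀ w u → PartialTree.covered T w ≡ true → PartialTree.covered T u ≡ false →
             E G w u → Σ PartialTree λ T′ → suc (count (PartialTree.covered T)) ≤ count (PartialTree.covered T′)
    attach T w u sw su e = T′ , grows
      where
      open PartialTree T
      old≢u : ∀ {y} → covered y ≡ true → y ≢ u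
      old≢u sy refl = true≢false (trans (sym sy) su)
      covered′ : V → Bool
      covered′ y = covered y ∨ does (y ≟ u)
      parent′ : V → V
      parent′ y = if does (y ≟ u) then w else parent y
      depth′ : V → ℕ
      depth′ y = if does (y ≟ u) then suc (depth w) else depth y
      old-depth : ∀ {y} → covered y ≡ true → depth′ y ≡ depth y
      old-depth {y} sy rewrite dec-false (y ≟ u) (old≢u sy) = refl
      old-covered : ∀ {y} → covered y ≡ true → covered′ y ≡ true
      old-covered {y} sy rewrite sy = refl
      parent-ok′ : ∀ y → covered′ y ≡ true → y ≢ r →
                   covered′ (parent′ y) ≡ true × E G (parent′ y) y × suc (depth′ (parent′ y)) ≡ depth′ y
      parent-ok′ y s′y y≢r with y ≟ u
      ... | yes refl = old-covered sw , e , cong suc (old-depth sw)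
      ... | no  _    with parent-ok y (trans (sym (∨-identityʳ (covered y))) s′y) y≢r
      ...   | sp , ep , dp = old-covered sp , ep , trans (cong suc (old-depth sp)) dp
      T′ : PartialTree
      T′ = record { covered = covered′ ; parent = parent′ ; depth = depth′
                  ; root-covered = old-covered root-covered
                  ; depth-root = trans (old-depth root-covered) depth-root ; parent-ok = parent-ok′ }
      grows : suc (count covered) ≤ count covered′
      grows = begin
        suc (count covered)                          ≡⟨ cong (_+ count covered) (sym (count-point u)) ⟩
        count (λ y → does (y ≟ u)) + count covered   ≡⟨ sym (∑-distrib-+ (λ y → ind (does (y ≟ u))) _) ⟩
        sum (λ y → ind (does (y ≟ u)) + ind (covered y)) ≤⟨ sum-mono pointwise ⟩
        count covered′                               ∎
        where
        open ≤-Reasoning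
        pointwise : ∀ y → ind (does (y ≟ u)) + ind (covered y) ≤ ind (covered′ y)
        pointwise y with y ≟ u
        ... | yes refl rewrite su = ≤-refl
        ... | no  _    = ≤-reflexive (cong ind (sym (∨-identityʳ (covered y))))

    complete : ∀ fuel (T : PartialTree) → N G ≤ count (PartialTree.covered T) + fuel →
               Σ PartialTree λ T′ → ∀ y → PartialTree.covered T′ y ≡ true
    complete fuel T enough with any? (λ x → PartialTree.covered T x Bool.≟ false)
    ... | no none = T , λ y → ¬-not (λ sy → none (y , sy))
    complete zero T enough | yes (x , sx) =
      contradiction (≤-trans enough (≤-reflexive (+-identityʳ _))) (<⇒≱ (count-missing _ sx))
    complete (suc fuel) T enough | yes (x , sx)
      with boundary-edge (PartialTree.covered T) (PartialTree.root-covered T) (connected r x tt tt) sx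
    ... | w , u , sw , su , e with attach T w u sw su e
    ...   | T′ , grows = complete fuel T′ (≤-trans enough (≤-trans (≤-reflexive (+-suc _ fuel)) (+-monoˡ-≤ fuel grows)))

    spanning-tree : RootedSpanningTree G r
    spanning-tree with complete (N G) root-only (m≤n+m (N G) _)
    ... | T , all = record
      { parent = parent ; depth = depth ; depth-root = depth-root
      ; parent-edge  = λ u u≢r → proj₁ (proj₂ (parent-ok u (all u) u≢r))
      ; parent-depth = λ u u≢r → proj₂ (proj₂ (parent-ok u (all u) u≢r)) }
      where open PartialTree T

  -- The counting invariant of the cutting procedure: a tree with c vertices
  -- and μ leaves still affords m pieces of q+1 vertices each.
  record Budget (q m μ c : ℕ) : Set where
    constructor affords
    field
      bound : m * suc q + μ * q + 1 ≤ c + 2 * q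

  budget-large : ∀ {q m μ c} → 2 ≤ μ → Budget q (suc m) μ c → suc q ≤ c
  budget-large {q} {m} {μ} {c} 2≤μ (affords budget) = +-cancelʳ-≤ (2 * q) (suc q) c (begin
    suc q + 2 * q                   ≤⟨ +-mono-≤ (m≤m+n (suc q) (m * suc q)) (*-monoˡ-≤ q 2≤μ) ⟩
    suc m * suc q + μ * q           ≤⟨ m≤m+n _ 1 ⟩
    suc m * suc q + μ * q + 1       ≤⟨ budget ⟩
    c + 2 * q                       ∎)
    where open ≤-Reasoning

  budget-singleton : ∀ {q m μ c} → 1 ≤ μ → c ≤ 1 → ¬ Budget q (suc m) μ c
  budget-singleton {q} {m} {μ} {c} 1≤μ c≤1 (affords budget) = <-irrefl refl (begin-strict
    1 + 2 * q                       <⟨ ≤-reflexive (lemma q) ⟩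
    suc q + 1 * q + 1               ≤⟨ +-monoˡ-≤ 1 (+-mono-≤ (m≤m+n (suc q) (m * suc q)) (*-monoˡ-≤ q 1≤μ)) ⟩
    suc m * suc q + μ * q + 1       ≤⟨ budget ⟩
    c + 2 * q                       ≤⟨ +-monoˡ-≤ (2 * q) c≤1 ⟩
    1 + 2 * q                       ∎)
    where
    open ≤-Reasoning
    lemma : ∀ q → suc (1 + 2 * q) ≡ suc q + 1 * q + 1
    lemma = solve-∀

  -- a tree made of a root and k ≤ μ subtrees of at most q vertices affords at
  -- most one piece
  budget-one-piece : ∀ {q m μ k c} → k ≤ μ → c ≤ 1 + k * q → ¬ Budget q (suc (suc m)) μ c
  budget-one-piece {q} {m} {μ} {k} {c} k≤μ c≤ (affords budget) = <-irrefl refl (begin-strict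
    1 + k * q + 2 * q               <⟨ ≤-trans (≤-reflexive (lemma k q)) (m≤m+n _ 1) ⟩
    2 * suc q + k * q + 1           ≤⟨ +-monoˡ-≤ 1 (+-mono-≤ (*-monoˡ-≤ (suc q) {2} {suc (suc m)} (s≤s (s≤s z≤n)))
                                                               (*-monoˡ-≤ q k≤μ)) ⟩
    suc (suc m) * suc q + μ * q + 1 ≤⟨ budget ⟩
    c + 2 * q                       ≤⟨ +-monoˡ-≤ (2 * q) c≤ ⟩
    1 + k * q + 2 * q               ∎)
    where
    open ≤-Reasoning
    lemma : ∀ k q → suc (1 + k * q + 2 * q) ≡ 2 * suc q + k * q
    lemma = solve-∀

  -- removing a piece of b ≤ 1 + kq vertices that costs k leaves while
  -- creating at most one keeps the invariant for the remaining pieces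
  budget-after-cut : ∀ {q m μ μ′ k a b} → b ≤ 1 + k * q → μ′ + k ≤ μ + 1 →
                     Budget q (suc m) μ (b + a) → Budget q m μ′ a
  budget-after-cut {q} {m} {μ} {μ′} {k} {a} {b} b≤ leaves (affords budget) = affords (+-cancelʳ-≤ (suc q + k * q) _ _ (begin
    m * suc q + μ′ * q + 1 + (suc q + k * q) ≡⟨ lemma₁ m μ′ k q ⟩
    suc m * suc q + (μ′ + k) * q + 1         ≤⟨ +-monoˡ-≤ 1 (+-monoʳ-≤ (suc m * suc q) (*-monoˡ-≤ q leaves)) ⟩
    suc m * suc q + (μ + 1) * q + 1          ≡⟨ lemma₂ m μ q ⟩
    (suc m * suc q + μ * q + 1) + q          ≤⟨ +-monoˡ-≤ q budget ⟩
    (b + a + 2 * q) + q                      ≤⟨ +-monoˡ-≤ q (+-monoˡ-≤ (2 * q) (+-monoˡ-≤ a b≤)) ⟩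
    ((1 + k * q) + a + 2 * q) + q            ≡⟨ lemma₃ k q a ⟩
    a + 2 * q + (suc q + k * q)              ∎))
    where
    open ≤-Reasoning
    lemma₁ : ∀ m μ′ k q → m * suc q + μ′ * q + 1 + (suc q + k * q) ≡ suc m * suc q + (μ′ + k) * q + 1
    lemma₁ = solve-∀
    lemma₂ : ∀ m μ q → suc m * suc q + (μ + 1) * q + 1 ≡ (suc m * suc q + μ * q + 1) + q
    lemma₂ = solve-∀
    lemma₃ : ∀ k q a → ((1 + k * q) + a + 2 * q) + q ≡ a + 2 * q + (suc q + k * q)
    lemma₃ = solve-∀

  -- fewer leaves only make the invariant easier; leaves are irrelevant when q = 0
  budget-fewer-leaves : ∀ {q m μ s c} → (0 < q → μ ≤ s) → Budget q m s c → Budget q m μ c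
  budget-fewer-leaves {zero}  {m} {μ} {s} {c} _ (affords budget) =
    affords (subst (λ x → m * 1 + x + 1 ≤ c + 2 * 0) (trans (*-zeroʳ s) (sym (*-zeroʳ μ))) budget)
  budget-fewer-leaves {suc q} {m} fewer (affords budget) = affords (
    ≤-trans (+-monoˡ-≤ 1 (+-monoʳ-≤ (m * suc (suc q)) (*-monoˡ-≤ (suc q) (fewer (s≤s z≤n))))) budget)

  budget-three : ∀ {q s c} → 0 < q → Budget q (suc q) s c → 3 ≤ c
  budget-three {suc q} {s} {c} _ (affords budget) with 3 ≤? c
  ... | yes 3≤c = 3≤c
  ... | no  3≰c = ⊥-elim (<-irrefl refl (begin-strict
    2 + 2 * suc q                                       <⟨ ≤-trans (m≤n+m _ (q * q + 2 * q)) (≤-reflexive (lemma₁ q)) ⟩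
    (q * q + 2 * q) + (2 + 2 * suc q) + 1               ≡⟨ lemma₂ q ⟩
    suc (suc q) * suc (suc q) + 1                       ≤⟨ +-monoˡ-≤ 1 (m≤m+n (suc (suc q) * suc (suc q)) (s * suc q)) ⟩
    suc (suc q) * suc (suc q) + s * suc q + 1           ≤⟨ budget ⟩
    c + 2 * suc q                                       ≤⟨ +-monoˡ-≤ (2 * suc q) (≤-pred (≰⇒> 3≰c)) ⟩
    2 + 2 * suc q                                       ∎))
    where
    open ≤-Reasoning
    lemma₁ : ∀ q → (q * q + 2 * q) + suc (2 + 2 * suc q) ≡ (q * q + 2 * q) + (2 + 2 * suc q) + 1
    lemma₁ = solve-∀
    lemma₂ : ∀ q → (q * q + 2 * q) + (2 + 2 * suc q) + 1 ≡ suc (suc q) * suc (suc q) + 1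
    lemma₂ = solve-∀

  module RootedTree (G : Graph) (r : Fin (N G)) (tree : RootedSpanningTree G r) where

    open RootedSpanningTree tree
    open Walks G

    private
      V : Set
      V = Fin (N G)

    parent-shallower : ∀ {u} → u ≢ r → depth (parent u) < depth u
    parent-shallower {u} u≢r = ≤-reflexive (parent-depth u u≢r)

    climb : ∀ {ℓ} (P : V → Set ℓ) → P r → (∀ u → u ≢ r → P (parent u) → P u) → ∀ u → P u
    climb P base extend u = go (depth u) u refl
      where
      go : ∀ k u → depth u ≡ k → P u
      go k u du with u ≟ r
      ... | yes refl = base
      go zero    u du | no u≢r = ⊥-elim (0≢1+n (trans (sym du) (sym (parent-depth u u≢r))))
      go (suc k) u du | no u≢r = extend u u≢r (go k (parent u) (suc-injective (trans (parent-depth u u≢r) du)))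

    data Ancestor (a : V) : V → Set where
      self : Ancestor a a
      up   : ∀ {u} → u ≢ r → Ancestor a (parent u) → Ancestor a u

    ancestor-depth : ∀ {a u} → Ancestor a u → depth a ≤ depth u
    ancestor-depth self           = ≤-refl
    ancestor-depth (up u≢r a≼pu) = ≤-trans (ancestor-depth a≼pu) (<⇒≤ (parent-shallower u≢r))

    ancestor-trans : ∀ {a b u} → Ancestor a b → Ancestor b u → Ancestor a u
    ancestor-trans a≼b self           = a≼b
    ancestor-trans a≼b (up u≢r b≼pu) = up u≢r (ancestor-trans a≼b b≼pu)

    ancestor-of-root : ∀ {a} → Ancestor a r → a ≡ r
    ancestor-of-root self          = refl
    ancestor-of-root (up r≢r _) = ⊥-elim (r≢r refl)

    root-ancestor : ∀ u → Ancestor r u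
    root-ancestor = climb (Ancestor r) self (λ _ → up)

    -- a child is strictly deeper than, hence not an ancestor of, its parent
    child-not-above-parent : ∀ {c u} → c ≢ r → Ancestor c u → Ancestor u (parent c) → ⊥
    child-not-above-parent c≢r c≼u u≼pc =
      <⇒≱ (parent-shallower c≢r) (≤-trans (ancestor-depth c≼u) (ancestor-depth u≼pc))

    ancestor? : ∀ a u → Dec (Ancestor a u)
    ancestor? a = climb (λ u → Dec (Ancestor a u)) (map′ (λ { refl → self }) ancestor-of-root (a ≟ r)) extend
      where
      extend : ∀ u → u ≢ r → Dec (Ancestor a (parent u)) → Dec (Ancestor a u)
      extend u u≢r a≼pu? with a ≟ u
      ... | yes refl = yes self
      ... | no  a≢u  = map′ (up u≢r) (λ { self → ⊥-elim (a≢u refl) ; (up _ a≼pu) → a≼pu }) a≼pu?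

    child-on-path : ∀ {v u} → Ancestor v u → u ≢ v → Σ V λ c → parent c ≡ v × c ≢ r × Ancestor c u
    child-on-path self u≢v = ⊥-elim (u≢v refl)
    child-on-path {v} (up {u} u≢r v≼pu) _ with parent u ≟ v
    ... | yes pu≡v = u , pu≡v , u≢r , self
    ... | no  pu≢v with child-on-path v≼pu pu≢v
    ...   | c , pc≡v , c≢r , c≼pu = c , pc≡v , c≢r , up u≢r c≼pu

    ancestors-comparable : ∀ {a b u} → Ancestor a u → Ancestor b u → Ancestor a b ⊎ Ancestor b a
    ancestors-comparable self        b≼u         = inj₂ b≼u
    ancestors-comparable (up u≢r a≼pu) self      = inj₁ (up u≢r a≼pu)
    ancestors-comparable (up _ a≼pu) (up _ b≼pu) = ancestors-comparable a≼pu b≼pu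

    sibling-unique : ∀ {c c′ u} → parent c ≡ parent c′ → c ≢ r → c′ ≢ r →
                     Ancestor c u → Ancestor c′ u → c ≡ c′
    sibling-unique {c} {c′} pc≡pc′ c≢r c′≢r c≼u c′≼u with ancestors-comparable c≼u c′≼u
    ... | inj₁ self = refl
    ... | inj₁ (up _ c≼pc′) = ⊥-elim (child-not-above-parent c≢r self (subst (Ancestor c) (sym pc≡pc′) c≼pc′))
    ... | inj₂ self = refl
    ... | inj₂ (up _ c′≼pc) = ⊥-elim (child-not-above-parent c′≢r self (subst (Ancestor c′) pc≡pc′ c′≼pc))

    -- Vertex sets.  R is closed when it contains the parent of each of its
    -- non-root vertices; a nonempty closed set spans a subtree containing r.
    Closed : (V → Bool) → Set
    Closed R = ∀ u → R u ≡ true → u ≢ r → R (parent u) ≡ true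

    everything : V → Bool
    everything _ = true

    everything-closed : Closed everything
    everything-closed _ _ _ = refl

    closed-ancestor : ∀ {R} → Closed R → ∀ {a u} → R u ≡ true → Ancestor a u → R a ≡ true
    closed-ancestor closed ru self          = ru
    closed-ancestor closed ru (up u≢r a≼pu) = closed-ancestor closed (closed _ ru u≢r) a≼pu

    subtree : (V → Bool) → V → V → Bool
    subtree R v u = R u ∧ does (ancestor? v u)

    subtree-intro : ∀ R {v u} → R u ≡ true → Ancestor v u → subtree R v u ≡ true
    subtree-intro R {v} {u} ru v≼u = ∧-intro ru (dec-true (ancestor? v u) v≼u)

    subtree-member : ∀ R {v u} → subtree R v u ≡ true → R u ≡ true
    subtree-member R {v} {u} h = ∧-conicalˡ (R u) _ h

    subtree-ancestor : ∀ R {v u} → subtree R v u ≡ true → Ancestor v u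
    subtree-ancestor R {v} {u} h = holds (ancestor? v u) (∧-conicalʳ (R u) _ h)

    IsChild : V → V → Set
    IsChild v c = parent c ≡ v × c ≢ r

    children : (V → Bool) → V → V → Bool
    children R v c = R c ∧ does ((parent c ≟ v) ×-dec ¬? (c ≟ r))

    children-intro : ∀ R {v c} → R c ≡ true → IsChild v c → children R v c ≡ true
    children-intro R {v} {c} rc ch = ∧-intro rc (dec-true ((parent c ≟ v) ×-dec ¬? (c ≟ r)) ch)

    children-member : ∀ R {v c} → children R v c ≡ true → R c ≡ true
    children-member R {v} {c} h = ∧-conicalˡ (R c) _ h

    children-child : ∀ R {v c} → children R v c ≡ true → IsChild v c
    children-child R {v} {c} h = holds ((parent c ≟ v) ×-dec ¬? (c ≟ r)) (∧-conicalʳ (R c) _ h)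

    #children : (V → Bool) → V → ℕ
    #children R v = count (children R v)

    child≤#children : ∀ R {v c} → R c ≡ true → IsChild v c → 1 ≤ #children R v
    child≤#children R {v} rc ch = member≤count (children R v) (children-intro R rc ch)

    -- the degree of u in the subtree spanned by R (children plus the parent edge)
    degree : (V → Bool) → V → ℕ
    degree R u = #children R u + ind (not (does (u ≟ r)))

    degree-nonroot : ∀ R {u} → u ≢ r → degree R u ≡ #children R u + 1
    degree-nonroot R {u} u≢r rewrite dec-false (u ≟ r) u≢r = refl

    degree-root : ∀ R → degree R r ≡ #children R r + 0
    degree-root R rewrite dec-true (r ≟ r) refl = refl

    leaves : (V → Bool) → V → Bool
    leaves R u = R u ∧ does (degree R u ≤? 1)

    leaves-intro : ∀ R {u} → R u ≡ true → degree R u ≤ 1 → leaves R u ≡ true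
    leaves-intro R {u} ru small = ∧-intro ru (dec-true (degree R u ≤? 1) small)

    leaves-member : ∀ R {u} → leaves R u ≡ true → R u ≡ true
    leaves-member R {u} h = ∧-conicalˡ (R u) _ h

    leaves-degree : ∀ R {u} → leaves R u ≡ true → degree R u ≤ 1
    leaves-degree R {u} h = holds (degree R u ≤? 1) (∧-conicalʳ (R u) _ h)

    #leaves : (V → Bool) → ℕ
    #leaves R = count (leaves R)

    child-below : ∀ {v c} → IsChild v c → Ancestor v c
    child-below (refl , c≢r) = up c≢r self

    subtree-connected : ∀ {R} → Closed R → ∀ v → ConnectedSet G (λ x → subtree R v x ≡ true)
    subtree-connected {R} closed v =
      connected-from v (λ u u∈ → down (subtree-member R u∈) (subtree-ancestor R u∈))
      where
      down : ∀ {u} → R u ≡ true → Ancestor v u → Reach G (λ x → subtree R v x ≡ true) v u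
      down ru self          = here (subtree-intro R ru self)
      down ru (up u≢r v≼pu) =
        step (down (closed _ ru u≢r) v≼pu) (subtree-intro R ru (up u≢r v≼pu)) (parent-edge _ u≢r)

    subtree-of-root : ∀ R → count (subtree R r) ≡ count R
    subtree-of-root R = sum-cong-≗ λ u → cong ind (trans
      (cong (R u ∧_) (dec-true (ancestor? r u) (root-ancestor u))) (∧-identityʳ (R u)))

    -- below every non-root vertex of R lies a leaf of R: take a deepest vertex
    -- of its subtree
    leaf-below : ∀ {R c} → R c ≡ true → c ≢ r → Σ V λ ℓ → leaves R ℓ ≡ true × Ancestor c ℓ
    leaf-below {R} {c} rc c≢r with maximise (subtree R c) depth (subtree-intro R rc self)
    ... | ℓ , ℓ∈ , deepest = ℓ , leaves-intro R (subtree-member R ℓ∈) degree≤1 , c≼ℓ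
      where
      c≼ℓ = subtree-ancestor R ℓ∈
      ℓ≢r : ℓ ≢ r
      ℓ≢r refl = c≢r (ancestor-of-root c≼ℓ)
      childless : ∀ x → children R ℓ x ≡ true → ⊥
      childless x x∈ with children-child R x∈
      ... | refl , x≢r = <⇒≱ (parent-shallower x≢r)
        (deepest x (subtree-intro R (children-member R x∈) (ancestor-trans c≼ℓ (child-below (refl , x≢r)))))
      degree≤1 : degree R ℓ ≤ 1
      degree≤1 = ≤-reflexive (trans (degree-nonroot R ℓ≢r) (cong (_+ 1) (count-empty childless)))

    -- distinct children of v have disjoint subtrees, each containing a leaf:
    -- so v has at most as many children as there are leaves below it
    children≤leaves-below : ∀ R v → #children R v ≤ count (subtree (leaves R) v)
    children≤leaves-below R v = begin
      #children R v                              ≤⟨ sum-mono has-leaf ⟩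
      sum (λ c → count (λ ℓ → pair c ℓ))          ≡⟨ ∑-comm (λ c ℓ → ind (pair c ℓ)) ⟩
      sum (λ ℓ → count (λ c → pair c ℓ))          ≤⟨ sum-mono one-child-above ⟩
      count (subtree (leaves R) v)                ∎
      where
      open ≤-Reasoning
      pair : V → V → Bool
      pair c ℓ = children R v c ∧ subtree (leaves R) c ℓ
      pair-child : ∀ {c ℓ} → pair c ℓ ≡ true → IsChild v c
      pair-child {c} {ℓ} h = children-child R (∧-conicalˡ (children R v c) _ h)
      pair-leaf : ∀ {c ℓ} → pair c ℓ ≡ true → subtree (leaves R) c ℓ ≡ true
      pair-leaf {c} {ℓ} h = ∧-conicalʳ (children R v c) _ h
      has-leaf : ∀ c → ind (children R v c) ≤ count (λ ℓ → pair c ℓ)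
      has-leaf c = ind≤ (children R v c) λ c∈ →
        let (ℓ , ℓ-leaf , c≼ℓ) = leaf-below {R} (children-member R c∈) (proj₂ (children-child R c∈))
        in  member≤count (λ ℓ → pair c ℓ) (∧-intro c∈ (subtree-intro (leaves R) ℓ-leaf c≼ℓ))
      one-child-above : ∀ ℓ → count (λ c → pair c ℓ) ≤ ind (subtree (leaves R) v ℓ)
      one-child-above ℓ = count≤ind (λ c → pair c ℓ) _ into unique
        where
        into : ∀ c → pair c ℓ ≡ true → subtree (leaves R) v ℓ ≡ true
        into c h = subtree-intro (leaves R) (subtree-member (leaves R) (pair-leaf h))
          (ancestor-trans (child-below (pair-child h)) (subtree-ancestor (leaves R) (pair-leaf h)))
        unique : ∀ c c′ → pair c ℓ ≡ true → pair c′ ℓ ≡ true → c ≡ c′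
        unique c c′ h h′ with pair-child h | pair-child h′
        ... | pc , c≢r | pc′ , c′≢r = sibling-unique (trans pc (sym pc′)) c≢r c′≢r
          (subtree-ancestor (leaves R) (pair-leaf h)) (subtree-ancestor (leaves R) (pair-leaf h′))

    -- a subtree is its root plus the subtrees of its children
    subtree-size : ∀ {R} → Closed R → ∀ v q → (∀ c → children R v c ≡ true → count (subtree R c) ≤ q) →
                   count (subtree R v) ≤ 1 + #children R v * q
    subtree-size {R} closed v q small = begin
      count (subtree R v)                                       ≤⟨ sum-mono split ⟩
      sum (λ u → ind (does (u ≟ v)) + sum (λ c → ind (inside c u)))
        ≡⟨ ∑-distrib-+ (λ u → ind (does (u ≟ v))) _ ⟩
      count (λ u → does (u ≟ v)) + sum (λ u → sum (λ c → ind (inside c u)))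
        ≡⟨ cong₂ _+_ (count-point v) (∑-comm (λ u c → ind (inside c u))) ⟩
      1 + sum (λ c → sum (λ u → ind (inside c u)))              ≡⟨ cong (1 +_) (sum-cong-≗ weight) ⟩
      1 + sum (λ c → ind (children R v c) * count (subtree R c)) ≤⟨ +-monoʳ-≤ 1 (sum-mono bounded) ⟩
      1 + sum (λ c → ind (children R v c) * q)                  ≡⟨ cong (1 +_) (sym (*-distribʳ-sum q (λ c → ind (children R v c)))) ⟩
      1 + #children R v * q                                     ∎
      where
      open ≤-Reasoning
      inside : V → V → Bool
      inside c u = children R v c ∧ subtree R c u
      split : ∀ u → ind (subtree R v u) ≤ ind (does (u ≟ v)) + sum (λ c → ind (inside c u))
      split u = ind≤ (subtree R v u) λ u∈ → lemma u∈
        where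
        lemma : subtree R v u ≡ true → 1 ≤ ind (does (u ≟ v)) + sum (λ c → ind (inside c u))
        lemma u∈ with u ≟ v
        ... | yes _   = s≤s z≤n
        ... | no  u≢v with child-on-path (subtree-ancestor R u∈) u≢v
        ...   | c , pc , c≢r , c≼u = member≤count (λ c → inside c u)
          (∧-intro (children-intro R (closed-ancestor closed (subtree-member R u∈) c≼u) (pc , c≢r))
                   (subtree-intro R (subtree-member R u∈) c≼u))
      weight : ∀ c → sum (λ u → ind (inside c u)) ≡ ind (children R v c) * count (subtree R c)
      weight c = trans (sum-cong-≗ (λ u → ind-∧ (children R v c) (subtree R c u)))
                       (sym (*-distribˡ-sum (ind (children R v c)) (λ u → ind (subtree R c u))))
      bounded : ∀ c → ind (children R v c) * count (subtree R c) ≤ ind (children R v c) * q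
      bounded c with children R v c in c∈
      ... | false = z≤n
      ... | true  = *-monoʳ-≤ 1 (small c c∈)

  module GreedyCutting (G : Graph) (r : Fin (N G)) (tree : RootedSpanningTree G r) where

    open RootedSpanningTree tree
    open RootedTree G r tree

    private
      V : Set
      V = Fin (N G)

    cut : (V → Bool) → V → V → Bool
    cut R v u = R u ∧ not (does (ancestor? v u))

    cut-intro : ∀ R {v u} → R u ≡ true → ¬ Ancestor v u → cut R v u ≡ true
    cut-intro R {v} {u} ru v⋠u = ∧-intro ru (cong not (dec-false (ancestor? v u) v⋠u))

    cut-member : ∀ R {v u} → cut R v u ≡ true → R u ≡ true
    cut-member R {v} {u} h = ∧-conicalˡ (R u) _ h

    cut-not-below : ∀ R {v u} → cut R v u ≡ true → ¬ Ancestor v u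
    cut-not-below R {v} {u} h = fails (ancestor? v u) (not-true (∧-conicalʳ (R u) _ h))

    cut-closed : ∀ {R} → Closed R → ∀ v → Closed (cut R v)
    cut-closed {R} closed v u u∈ u≢r =
      cut-intro R (closed u (cut-member R u∈) u≢r) (λ v≼pu → cut-not-below R u∈ (up u≢r v≼pu))

    cut-keeps-root : ∀ {R v} → R r ≡ true → v ≢ r → cut R v r ≡ true
    cut-keeps-root {R} rr v≢r = cut-intro R rr (λ v≼r → v≢r (ancestor-of-root v≼r))

    children-after-cut : ∀ R v {u} → ¬ Ancestor v u → u ≢ parent v → #children (cut R v) u ≡ #children R u
    children-after-cut R v {u} v⋠u u≢pv = sum-cong-≗ λ c → cong ind (same c)
      where
      kept : ∀ {c} → IsChild u c → ¬ Ancestor v c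
      kept (refl , _)   self           = u≢pv refl
      kept (refl , _)   (up _ v≼pc) = v⋠u v≼pc
      same : ∀ c → children (cut R v) u c ≡ children R u c
      same c = bool-ext
        (λ h → children-intro R (cut-member R (children-member (cut R v) {u} {c} h)) (children-child (cut R v) h))
        (λ h → children-intro (cut R v) (cut-intro R (children-member R {u} {c} h) (kept (children-child R h)))
                                         (children-child R h))

    -- cutting off the subtree of v loses the leaves below v, of which there are
    -- at least as many as children of v, and creates at most one new leaf, parent v
    leaves-after-cut : ∀ R v → #leaves (cut R v) + #children R v ≤ #leaves R + 1
    leaves-after-cut R v = begin
      #leaves (cut R v) + #children R v ≤⟨ +-mono-≤ (sum-mono new-leaf) (children≤leaves-below R v) ⟩
      sum (λ u → ind (cut (leaves R) v u) + ind (does (u ≟ parent v))) + below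
        ≡⟨ cong (_+ below) (∑-distrib-+ (λ u → ind (cut (leaves R) v u)) _) ⟩
      (kept + count (λ u → does (u ≟ parent v))) + below  ≡⟨ cong (λ k → (kept + k) + below) (count-point (parent v)) ⟩
      (kept + 1) + below                                  ≡⟨ trans (+-comm (kept + 1) below) (sym (+-assoc below kept 1)) ⟩
      (below + kept) + 1                                  ≡⟨ cong (_+ 1) (sym (count-split (leaves R) (λ u → does (ancestor? v u)))) ⟩
      #leaves R + 1                                       ∎
      where
      open ≤-Reasoning
      below = count (subtree (leaves R) v)
      kept  = count (cut (leaves R) v)
      new-leaf : ∀ u → ind (leaves (cut R v) u) ≤ ind (cut (leaves R) v u) + ind (does (u ≟ parent v))
      new-leaf u with u ≟ parent v
      ... | yes _    = ≤-trans (ind≤1 _) (m≤n+m 1 _)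
      ... | no u≢pv = ≤-trans (ind-mono old-leaf) (m≤m+n _ _)
        where
        old-leaf : leaves (cut R v) u ≡ true → cut (leaves R) v u ≡ true
        old-leaf h = cut-intro (leaves R) (leaves-intro R (cut-member R u∈) same-degree) (cut-not-below R u∈)
          where
          u∈ = leaves-member (cut R v) h
          same-degree : degree R u ≤ 1
          same-degree = subst (λ k → k + ind (not (does (u ≟ r))) ≤ 1)
            (children-after-cut R v (cut-not-below R u∈) u≢pv) (leaves-degree (cut R v) h)

    #children≤#leaves : ∀ R v → #children R v ≤ #leaves R
    #children≤#leaves R v = ≤-trans (children≤leaves-below R v) (count-mono (λ x → subtree-member (leaves R) {v} {x}))

    only-root : ∀ {R} → Closed R → #children R r ≡ 0 → count R ≤ 1
    only-root {R} closed childless = ≤-trans (count-mono is-root) (≤-reflexive (count-point r))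
      where
      is-root : ∀ u → R u ≡ true → does (u ≟ r) ≡ true
      is-root u ru with u ≟ r
      ... | yes _   = refl
      ... | no  u≢r with child-on-path (root-ancestor u) u≢r
      ...   | c , pc , c≢r , c≼u = contradiction (child≤#children R (closed-ancestor closed ru c≼u) (pc , c≢r))
                                                 (subst (λ k → ¬ 1 ≤ k) (sym childless) λ ())

    -- if the root has a child, a leaf below that child and either the root
    -- (when it is a leaf) or a second child give two leaves
    two-leaves : ∀ {R} → R r ≡ true → 1 ≤ #children R r → 2 ≤ #leaves R
    two-leaves {R} rr has-child with count-witness (children R r) has-child
    ... | c , c∈ with leaf-below {R} (children-member R c∈) (proj₂ (children-child R c∈))
    ...   | ℓ , ℓ-leaf , c≼ℓ with #children R r in k≡
    ...     | zero        = contradiction has-child λ ()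
    ...     | suc zero    = two≤count (leaves R) r≢ℓ (leaves-intro R rr root-degree) ℓ-leaf
      where
      r≢ℓ : r ≢ ℓ
      r≢ℓ refl = proj₂ (children-child R c∈) (ancestor-of-root c≼ℓ)
      root-degree : degree R r ≤ 1
      root-degree = ≤-reflexive (trans (degree-root R) (cong (_+ 0) k≡))
    ...     | suc (suc k) = ≤-trans (s≤s (s≤s z≤n)) (≤-trans (≤-reflexive (sym k≡)) (#children≤#leaves R r))

    add-subtree-piece : ∀ {q m R v} → Closed R → suc q ≤ count (subtree R v) → Pieces G q m (cut R v) →
                        Pieces G q (suc m) R
    add-subtree-piece {q} {m} {R} {v} closed big rest = record
      { piece = piece′ ; inside = inside′ ; large = large′ ; connected = connected′ ; disjoint = disjoint′ }
      where
      open Pieces rest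
      piece′ : Fin (suc m) → V → Bool
      piece′ zero    = subtree R v
      piece′ (suc i) = piece i
      inside′ : ∀ i x → piece′ i x ≡ true → R x ≡ true
      inside′ zero    x h = subtree-member R h
      inside′ (suc i) x h = cut-member R (inside i x h)
      large′ : ∀ i → suc q ≤ count (piece′ i)
      large′ zero    = big
      large′ (suc i) = large i
      connected′ : ∀ i → ConnectedSet G (λ x → piece′ i x ≡ true)
      connected′ zero    = subtree-connected closed v
      connected′ (suc i) = connected i
      disjoint′ : ∀ i j x → i ≢ j → piece′ i x ≡ true → piece′ j x ≡ true → ⊥
      disjoint′ zero    zero    x i≢j _ _ = i≢j refl
      disjoint′ zero    (suc j) x _ h h′ = cut-not-below R (inside j x h′) (subtree-ancestor R h)
      disjoint′ (suc i) zero    x _ h h′ = cut-not-below R (inside i x h) (subtree-ancestor R h′)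
      disjoint′ (suc i) (suc j) x i≢j h h′ = disjoint i j x (λ i≡j → i≢j (cong suc i≡j)) h h′

    large-tree : ∀ {q m R} → Closed R → R r ≡ true → Budget q (suc m) (#leaves R) (count R) → suc q ≤ count R
    large-tree {q} {m} {R} closed rr budget with #children R r in k≡
    ... | zero  = ⊥-elim (budget-singleton (member≤count (leaves R) root-leaf) (only-root closed k≡) budget)
      where
      root-leaf : leaves R r ≡ true
      root-leaf = leaves-intro R rr (≤-trans (≤-reflexive (trans (degree-root R) (cong (_+ 0) k≡))) z≤n)
    ... | suc k = budget-large (two-leaves rr (≤-trans (s≤s z≤n) (≤-reflexive (sym k≡)))) budget

    -- a deepest vertex v of R whose subtree has more than q vertices: its
    -- children's subtrees have at most q vertices each
    deepest-large-subtree : ∀ {R} q → Closed R → R r ≡ true → suc q ≤ count R →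
      Σ V λ v → suc q ≤ count (subtree R v) × count (subtree R v) ≤ 1 + #children R v * q
    deepest-large-subtree {R} q closed rr big = deepest-of (maximise large depth root-large)
      where
      large : V → Bool
      large u = R u ∧ does (suc q ≤? count (subtree R u))
      root-large : large r ≡ true
      root-large = ∧-intro rr (dec-true (suc q ≤? _) (subst (suc q ≤_) (sym (subtree-of-root R)) big))
      deepest-of : Maximiser large depth →
                   Σ V λ v → suc q ≤ count (subtree R v) × count (subtree R v) ≤ 1 + #children R v * q
      deepest-of (v , v-large , deepest) =
        v , holds (suc q ≤? _) (∧-conicalʳ (R v) _ v-large) , subtree-size closed v q small-children
        where
        small-children : ∀ c → children R v c ≡ true → count (subtree R c) ≤ q
        small-children c c∈ with children-child R c∈
        ... | refl , c≢r = ≮⇒≥ λ c-large → <⇒≱ (parent-shallower c≢r)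
          (deepest c (∧-intro (children-member R c∈) (dec-true (suc q ≤? _) c-large)))

    -- Greedy cutting: repeatedly cut off a deepest large subtree.  If that
    -- subtree is all of R, the budget allows only one piece; otherwise the rest
    -- of R is closed and, by leaves-after-cut, affords the remaining pieces.
    cut-pieces : ∀ q m {R} → Closed R → R r ≡ true → Budget q m (#leaves R) (count R) → Pieces G q m R
    cut-pieces q zero closed rr budget = no-pieces
    cut-pieces q (suc m) {R} closed rr budget
      with deepest-large-subtree q closed rr (large-tree closed rr budget)
    ... | v , big , size = cut-at v big size (v ≟ r)
      where
      cut-at : ∀ v → suc q ≤ count (subtree R v) → count (subtree R v) ≤ 1 + #children R v * q →
               Dec (v ≡ r) → Pieces G q (suc m) R
      cut-at v big size (no v≢r) = add-subtree-piece closed big (cut-pieces q m (cut-closed closed v)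
        (cut-keeps-root {R} rr v≢r) (budget-after-cut size (leaves-after-cut R v) split-budget))
        where
        split-budget : Budget q (suc m) (#leaves R) (count (subtree R v) + count (cut R v))
        split-budget = subst (Budget q (suc m) (#leaves R)) (count-split R (λ u → does (ancestor? v u))) budget
      cut-at .r big size (yes refl) = single-piece budget (subst (λ k → k ≤ 1 + #children R r * q) (subtree-of-root R) size)
        where
        single-piece : ∀ {k} → Budget q (suc k) (#leaves R) (count R) → count R ≤ 1 + #children R r * q →
                       Pieces G q (suc k) R
        single-piece {zero}  _      _     = add-subtree-piece closed big no-pieces
        single-piece {suc k} budget small = ⊥-elim (budget-one-piece (#children≤#leaves R r) small budget)

  module LeafStar (G : Graph) (r : Fin (N G)) (tree : RootedSpanningTree G r) where

    open RootedSpanningTree tree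
    open Walks G
    open RootedTree G r tree

    private
      V : Set
      V = Fin (N G)

    internal : V → Bool
    internal u = not (leaves everything u)

    internal-leaf : ∀ {u} → internal u ≡ true → leaves everything u ≡ true → ⊥
    internal-leaf {u} int leaf = true≢false (trans (sym leaf) (not-true int))

    parent-internal : ∀ {w c} → IsChild w c → w ≢ r → internal w ≡ true
    parent-internal {w} w-child w≢r = cong not (dec-false (degree everything w ≤? 1) λ small →
      <⇒≱ (+-monoˡ-≤ 1 (child≤#children everything refl w-child))
          (≤-trans (≤-reflexive (sym (degree-nonroot everything w≢r))) small))

    third-vertex : 3 ≤ N G → ∀ a b → Σ V λ x → x ≢ a × x ≢ b
    third-vertex three a b with any? (λ x → ¬? (x ≟ a) ×-dec ¬? (x ≟ b))
    ... | yes found = found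
    ... | no  none  = ⊥-elim (<⇒≱ three (begin
      N G              ≡⟨ sym (sum-ones (N G)) ⟩
      count everything ≤⟨ count≤2 everything a b cover ⟩
      2                ∎))
      where
      open ≤-Reasoning
      cover : ∀ x → everything x ≡ true → x ≡ a ⊎ x ≡ b
      cover x _ with x ≟ a | x ≟ b
      ... | yes x≡a | _       = inj₁ x≡a
      ... | no  _   | yes x≡b = inj₂ x≡b
      ... | no  x≢a | no  x≢b = ⊥-elim (none (x , x≢a , x≢b))

    HubBelowRoot : Set
    HubBelowRoot = Σ V λ c → IsChild r c × internal c ≡ true × internal r ≡ false × (∀ u → u ≢ r → Ancestor c u)

    root-or-hub : 3 ≤ N G → internal r ≡ true ⊎ HubBelowRoot
    root-or-hub three with leaves everything r in r-leaf
    ... | false = inj₁ refl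
    ... | true with third-vertex three r r
    ...   | u , u≢r , _ with child-on-path (root-ancestor u) u≢r
    ...     | c , pc , c≢r , _ = inj₂ (c , (pc , c≢r) , c-internal , refl , above-all)
      where
      one-child : #children everything r ≤ 1
      one-child = ≤-trans (≤-reflexive (sym (+-identityʳ _)))
                          (≤-trans (≤-reflexive (sym (degree-root everything))) (leaves-degree everything r-leaf))
      above-all : ∀ u → u ≢ r → Ancestor c u
      above-all u u≢r with child-on-path (root-ancestor u) u≢r
      ... | c′ , pc′ , c′≢r , c′≼u = subst (λ x → Ancestor x u)
        (count≤1⇒unique (children everything r) one-child (children-intro everything refl (pc′ , c′≢r))
                                                           (children-intro everything refl (pc , c≢r))) c′≼u
      -- a third vertex lies strictly below c, so c has a child
      c-internal : internal c ≡ true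
      c-internal with third-vertex three r c
      ... | x , x≢r , x≢c with child-on-path (above-all x x≢r) x≢c
      ...   | d , pd , d≢r , _ = parent-internal (pd , d≢r) c≢r

    hub : 3 ≤ N G → Σ V λ h → internal h ≡ true × (∀ u → internal u ≡ true → Ancestor h u)
    hub three with root-or-hub three
    ... | inj₁ r-int = r , r-int , λ u _ → root-ancestor u
    ... | inj₂ (c , _ , c-int , r-leaf , above) = c , c-int , λ u u-int → above u (λ { refl → true≢false (trans (sym u-int) r-leaf) })

    -- the internal vertices induce a connected subgraph: the path from an
    -- internal vertex up to the hub only passes through vertices with children
    internal-connected : 3 ≤ N G → ConnectedSet G (λ x → internal x ≡ true)
    internal-connected three with hub three
    ... | h , h-int , h-above = connected-from h (λ u u-int → path-up (h-above u u-int) u-int)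
      where
      parent-int : ∀ {u} → u ≢ r → Ancestor h (parent u) → Dec (parent u ≡ r) → internal (parent u) ≡ true
      parent-int u≢r h≼pu (yes pu≡r) = subst (λ x → internal x ≡ true)
        (trans (ancestor-of-root (subst (Ancestor h) pu≡r h≼pu)) (sym pu≡r)) h-int
      parent-int u≢r h≼pu (no  pu≢r) = parent-internal (refl , u≢r) pu≢r
      path-up : ∀ {u} → Ancestor h u → internal u ≡ true → Reach G (λ x → internal x ≡ true) h u
      path-up self          u-int = here u-int
      path-up {u} (up u≢r h≼pu) u-int =
        step (path-up h≼pu (parent-int u≢r h≼pu (parent u ≟ r))) u-int (parent-edge u u≢r)

    leaf-neighbour : 3 ≤ N G → ∀ ℓ → leaves everything ℓ ≡ true → Σ V λ w → internal w ≡ true × E G w ℓ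
    leaf-neighbour three ℓ ℓ-leaf = neighbour (ℓ ≟ r) (root-or-hub three)
      where
      root-neighbour : Dec (parent ℓ ≡ r) → internal r ≡ true ⊎ HubBelowRoot → ℓ ≢ r → Σ V λ w → internal w ≡ true × E G w ℓ
      root-neighbour (no pℓ≢r) _ ℓ≢r = parent ℓ , parent-internal (refl , ℓ≢r) pℓ≢r , parent-edge ℓ ℓ≢r
      root-neighbour (yes pℓ≡r) (inj₁ r-int) ℓ≢r =
        parent ℓ , subst (λ x → internal x ≡ true) (sym pℓ≡r) r-int , parent-edge ℓ ℓ≢r
      root-neighbour (yes pℓ≡r) (inj₂ (c , (pc , c≢r) , c-int , _ , above)) ℓ≢r =
        ⊥-elim (internal-leaf (subst (λ x → internal x ≡ true) c≡ℓ c-int) ℓ-leaf)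
        where
        c≡ℓ : c ≡ ℓ
        c≡ℓ = sibling-unique (trans pc (sym pℓ≡r)) c≢r ℓ≢r (above ℓ ℓ≢r) self
      neighbour : Dec (ℓ ≡ r) → internal r ≡ true ⊎ HubBelowRoot → Σ V λ w → internal w ≡ true × E G w ℓ
      neighbour (yes refl) (inj₁ r-int) = ⊥-elim (internal-leaf r-int ℓ-leaf)
      neighbour (yes refl) (inj₂ (c , (pc , c≢r) , c-int , _)) =
        c , c-int , trans (Graph.sym G c ℓ) (subst (λ x → E G x c) pc (parent-edge c c≢r))
      neighbour (no ℓ≢r) root-case = root-neighbour (parent ℓ ≟ r) root-case ℓ≢r

    -- Contracting the internal vertices to a single vertex exhibits a star
    -- whose leaves are the leaves of the spanning tree.
    leaf-star-minor : 3 ≤ N G → IsMinor (Star (#leaves everything)) G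
    leaf-star-minor three = subst (λ t → IsMinor (Star t) G) (enum-length (leaves everything)) model
      where
      L : List V
      L = enum (leaves everything)
      leaf-at : ∀ i → leaves everything (lookup L i) ≡ true
      leaf-at i = enum-sound (leaves everything) (∈-lookup i)
      branch : Fin (suc (length L)) → V → Set
      branch zero    x = internal x ≡ true
      branch (suc i) x = x ≡ lookup L i
      nonempty : ∀ i → Σ V (branch i)
      nonempty zero    = let (h , h-int , _) = hub three in h , h-int
      nonempty (suc i) = lookup L i , refl
      connected : ∀ i → ConnectedSet G (branch i)
      connected zero    = internal-connected three
      connected (suc i) u w refl refl = here refl
      disjoint : ∀ i j x → i ≢ j → branch i x → branch j x → ⊥
      disjoint zero    zero    x i≢j _ _ = i≢j refl
      disjoint zero    (suc j) x _ x-int refl = internal-leaf x-int (leaf-at j)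
      disjoint (suc i) zero    x _ refl x-int = internal-leaf x-int (leaf-at i)
      disjoint (suc i) (suc j) x i≢j refl x≡ =
        i≢j (cong suc (lookup-injective L (enum-unique (leaves everything)) i j x≡))
      edges : ∀ i j → E (Star (length L)) i j → Σ V λ u → Σ V λ v → branch i u × branch j v × E G u v
      edges zero    zero    ()
      edges (suc i) (suc j) ()
      edges zero    (suc j) _ = let (w , w-int , e) = leaf-neighbour three (lookup L j) (leaf-at j)
                                in w , lookup L j , w-int , refl , e
      edges (suc i) zero    _ = let (w , w-int , e) = leaf-neighbour three (lookup L i) (leaf-at i)
                                in lookup L i , w , refl , w-int , trans (Graph.sym G (lookup L i) w) e
      model : MinorModel (Star (length L)) G
      model = record { branch = branch ; nonempty = nonempty ; connected = connected
                     ; disjoint = disjoint ; edges = edges }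

  -- The theorem holds for every connected graph G:
  -- if s bounds the number of leaves of star minors of G and G has enough
  -- vertices for the budget of q+1 pieces, then G has q+1 disjoint connected
  -- vertex sets of q+1 vertices each.
  connected-graph-subtrees : ∀ G → Connected G → Fin (N G) → ∀ q s →
    (∀ t → IsMinor (Star t) G → t ≤ s) → Budget q (suc q) s (N G) → DisjointSubtrees G (suc q)
  connected-graph-subtrees G connected r q s star-bound budget =
    pieces-to-subtrees (cut-pieces q (suc q) everything-closed refl leaf-budget)
    where
    tree = SpanningTreeConstruction.spanning-tree G connected r
    open GreedyCutting G r tree using (cut-pieces)
    open RootedTree G r tree using (everything; everything-closed; #leaves)
    open LeafStar G r tree using (leaf-star-minor)
    leaf-budget : Budget q (suc q) (#leaves everything) (count everything)
    leaf-budget = subst (Budget q (suc q) (#leaves everything)) (sym (sum-ones (N G)))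
      (budget-fewer-leaves (λ q>0 → star-bound _ (leaf-star-minor (budget-three q>0 budget))) budget)

module IntegerHypothesis where

  open import Data.Nat using (ℕ; suc) renaming (_+_ to _+ℕ_; _*_ to _*ℕ_)
  open import Data.Integer using (ℤ; +_; _+_; _-_; _*_) renaming (_≤_ to _≤ℤ_)
  open import Data.Integer.Properties using (pos-+; pos-*; drop‿+≤+; +-monoˡ-≤; module ≤-Reasoning)
  open import Data.Integer.Tactic.RingSolver using (solve-∀)
  open import Relation.Binary.PropositionalEquality
  open Proof using (Budget; affords)

  -- for n = q + 1 the hypothesis n² + (s − 2)(n − 1) + 1 ≤ c is the budget
  -- (q + 1)² + sq + 1 ≤ c + 2q for n pieces
  budget-from-hypothesis : ∀ q s c →
    (+ suc q * + suc q) + ((+ s - + 2) * (+ suc q - + 1)) + + 1 ≤ℤ + c → Budget q (suc q) s c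
  budget-from-hypothesis q s c hyp = affords (drop‿+≤+ (begin
    + (suc q *ℕ suc q +ℕ s *ℕ q +ℕ 1)                                     ≡⟨ as-integers ⟩
    (+ suc q * + suc q) + ((+ s - + 2) * (+ suc q - + 1)) + + 1 + + (2 *ℕ q) ≤⟨ +-monoˡ-≤ (+ (2 *ℕ q)) hyp ⟩
    + c + + (2 *ℕ q)                                                      ≡⟨ sym (pos-+ c (2 *ℕ q)) ⟩
    + (c +ℕ 2 *ℕ q)                                                       ∎))
    where
    open ≤-Reasoning
    identity : ∀ (Q S : ℤ) → (+ 1 + Q) * (+ 1 + Q) + (S - + 2) * ((+ 1 + Q) - + 1) + + 1 + + 2 * Q
                              ≡ (+ 1 + Q) * (+ 1 + Q) + S * Q + + 1
    identity = solve-∀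
    as-integers : + (suc q *ℕ suc q +ℕ s *ℕ q +ℕ 1)
                  ≡ (+ suc q * + suc q) + ((+ s - + 2) * (+ suc q - + 1)) + + 1 + + (2 *ℕ q)
    as-integers = begin-equality
      + (suc q *ℕ suc q +ℕ s *ℕ q +ℕ 1)              ≡⟨ pos-+ (suc q *ℕ suc q +ℕ s *ℕ q) 1 ⟩
      + (suc q *ℕ suc q +ℕ s *ℕ q) + + 1             ≡⟨ cong (_+ + 1) (pos-+ (suc q *ℕ suc q) (s *ℕ q)) ⟩
      + (suc q *ℕ suc q) + + (s *ℕ q) + + 1          ≡⟨ cong₂ (λ a b → a + b + + 1) (pos-* (suc q) (suc q)) (pos-* s q) ⟩
      + suc q * + suc q + + s * + q + + 1              ≡⟨ cong (λ z → z * z + + s * + q + + 1) (pos-+ 1 q) ⟩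
      (+ 1 + + q) * (+ 1 + + q) + + s * + q + + 1      ≡⟨ sym (identity (+ q) (+ s)) ⟩
      (+ 1 + + q) * (+ 1 + + q) + (+ s - + 2) * ((+ 1 + + q) - + 1) + + 1 + + 2 * + q
        ≡⟨ cong₂ (λ z w → z * z + (+ s - + 2) * (z - + 1) + + 1 + w) (sym (pos-+ 1 q)) (sym (pos-* 2 q)) ⟩
      (+ suc q * + suc q) + ((+ s - + 2) * (+ suc q - + 1)) + + 1 + + (2 *ℕ q) ∎

open import Defs
open import Data.Nat using (ℕ; suc; _≤_)
open import Data.Product using (_,_)
open import Data.Integer using (+_; _+_; _-_; _*_) renaming (_≤_ to _≤ℤ_)
open Proof using (connected-graph-subtrees)
open IntegerHypothesis using (budget-from-hypothesis)

mainTheorem11 : (T : Graph) → IsTree T → HasEdge T →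
    (s : ℕ) → IsStarMinorNumber T s →
    (n : ℕ) → 1 ≤ n →
    (+ n * + n) + ((+ s - + 2) * (+ n - + 1)) + + 1 ≤ℤ + (N T) →
    DisjointSubtrees T n
mainTheorem11 T (connected , _) (u₀ , _) s (_ , maximal) (suc q) _ hyp =
  connected-graph-subtrees T connected u₀ q s maximal (budget-from-hypothesis q s (N T) hyp)
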